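{- Suppose that rooted $n$-premaniplexes $(\mathcal M_1,\Phi_1)$ and $(\mathcal M_2,\Phi_2)$ are both $(\mathcal T,\Psi)$-admissible for some rooted $n$-premaniplex $(\mathcal T,\Psi)$, and that $\mathcal M_1\mathbin{\diamondsuit}\mathcal M_2$ is a polytope. Let $(\Psi_1,\Psi_2)$ be a flag of $\mathcal M_1\mathbin{\diamondsuit}\mathcal M_2$ and, for $i\in\{1,2\}$, let $\mathcal K_i,\mathcal L_i,\mathcal N_i$ be the facet, vertex-figure and medial section of $\Psi_i$ in $\mathcal M_i$, rooted at $\Psi_i$. Then \[ X(\mathcal K_2\mid\mathcal K_1)\cap X(\mathcal L_2\mid\mathcal L_1)\le X(\mathcal N_2\mid\mathcal N_1) \] as subgroups of $\Gamma(\mathcal M_2)$.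
   Context: An $n$-premaniplex is a connected graph whose edges (multiple edges and semi-edges allowed) are coloured by $\{0,\dots,n-1\}$ so that each vertex (flag) is incident to exactly one edge of each colour and, for $|i-j|>1$, each component of the subgraph of colours $i,j$ is a quotient of an alternating 4-cycle; $\Phi^i$ is the flag joined to $\Phi$ by its colour-$i$ edge. $W_n=\langle r_0,\dots,r_{n-1}\mid r_i^2,\ (r_ir_j)^2\ (|i-j|>1)\rangle$ acts on flags by $r_i\Phi=\Phi^i$. A premaniplex is a polytope if it is (a maniplex, i.e. has no semi-edges or multiple edges, and is) isomorphic to the flag graph of an abstract $n$-polytope. Facet / vertex-figure / medial section of $\Phi$: component containing $\Phi$ after deleting colour $n-1$ / colour $0$ (colours shifted down by one) / colours $0,n-1$ (colours shifted down). Automorphisms are colour-preserving graph automorphisms acting on the right; $\Gamma(\mathcal M)$ is the automorphism group. Mix of rooted premaniplexes $(\mathcal M_1,\Phi_1),(\mathcal M_2,\Phi_2)$: component containing $(\Phi_1,\Phi_2)$ of the graph on $V(\mathcal M_1)\times V(\mathcal M_2)$ with $(\Lambda_1,\Lambda_2)^i=(\Lambda_1^i,\Lambda_2^i)$. $(\mathcal M,\Phi)$ is $(\mathcal T,\Psi)$-admissible if $\mathrm{Stab}_{W_n}(\Phi)\le\mathrm{Stab}_{W_n}(\Psi)\le\mathrm{Norm}_{W_n}(\mathrm{Stab}_{W_n}(\Phi))$. Variance groups: for rooted $m$-premaniplexes $(\mathcal A,\Phi_A),(\mathcal B,\Phi_B)$ with $N_A=\mathrm{Stab}_{W_m}(\Phi_A)$,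 $N_B=\mathrm{Stab}_{W_m}(\Phi_B)$ and $N_A\trianglelefteq N_AN_B$, $X(\mathcal A\mid\mathcal B)=N_AN_B/N_A$, regarded as a subgroup of $\Gamma(\mathcal A)\cong\mathrm{Norm}_{W_m}(N_A)/N_A$ ($wN_A\leftrightarrow\gamma$ with $\Phi_A\gamma=w\Phi_A$). A subgroup of $\Gamma(\mathcal K_2)$, for $\mathcal K_2$ a section of a flag of $\mathcal M_2$, is regarded as the set of $\gamma\in\Gamma(\mathcal M_2)$ mapping $\mathcal K_2$ to itself whose restriction to $\mathcal K_2$ lies in it. -}

module Defs where

open import Data.Nat using (ℕ; zero; suc) renaming (_<_ to _<ℕ_)
open import Data.Fin using (Fin; zero; suc; inject₁; toℕ) renaming (_<_ to _<ᶠ_; _≤_ to _≤ᶠ_)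
open import Data.List using (List; []; _∷_; _++_; map; reverse)
open import Data.Product using (Σ; ∃; _×_; _,_; proj₁; proj₂; ∃-syntax)
open import Data.Sum using (_⊎_)
open import Data.Empty using (⊥)
open import Relation.Binary.PropositionalEquality using (_≡_; _≢_; refl; cong)

-- The word (i₁ ∷ i₂ ∷ … ∷ []) denotes r_{i₁} r_{i₂} …, so that
-- concatenation is the product in W_n and act (i ∷ w) Φ = r_i (w Φ).
-- Every predicate on words used below (stabilizers, normalizers) is
-- invariant under the defining relations of W_n, so it is a predicate
-- on group elements.

act : {F : Set} {n : ℕ} → (Fin n → F → F) → List (Fin n) → F → F
act r [] Φ = Φ
act r (i ∷ w) Φ = r i (act r w Φ)

FarApart : {n : ℕ} → Fin n → Fin n → Set
FarApart i j = (suc (toℕ i) <ℕ toℕ j) ⊎ (suc (toℕ j) <ℕ toℕ i)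

-- The colour-i edge at Φ joins Φ to r i Φ
-- (a semi-edge when r i Φ ≡ Φ; multiple edges when r i Φ ≡ r j Φ).
-- "Each component of the (i,j)-subgraph, |i-j|>1, is a quotient of an
-- alternating 4-cycle" is the condition (r_i r_j)^2 Φ = Φ.

record Premaniplex (n : ℕ) : Set₁ where
  field
    Flag      : Set
    r         : Fin n → Flag → Flag
    r-invol   : ∀ i Φ → r i (r i Φ) ≡ Φ
    r-comm    : ∀ i j → FarApart i j → ∀ Φ → r i (r j (r i (r j Φ))) ≡ Φ
    connected : ∀ Φ Ψ → ∃[ w ] act r w Φ ≡ Ψ

open Premaniplex public

actM : {n : ℕ} (M : Premaniplex n) → List (Fin n) → Flag M → Flag M
actM M = act (r M)

Stab : {n : ℕ} (M : Premaniplex n) → Flag M → List (Fin n) → Set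
Stab M Φ w = actM M w Φ ≡ Φ

-- w ∈ Norm_{W_n}(N)  (w N w⁻¹ = N; the inverse of a word is its reverse)
InNorm : {n : ℕ} → (List (Fin n) → Set) → List (Fin n) → Set
InNorm N w = (∀ u → N u → N (w ++ u ++ reverse w))
           × (∀ u → N u → N (reverse w ++ u ++ w))

Admissible : {n : ℕ} (M : Premaniplex n) → Flag M → (T : Premaniplex n) → Flag T → Set
Admissible M Φ T Ψ = (∀ w → Stab M Φ w → Stab T Ψ w)
                   × (∀ w → Stab T Ψ w → InNorm (Stab M Φ) w)

-- The mix (M₁,Φ₁) ◇ (M₂,Φ₂): the component of (Φ₁,Φ₂).  Its flags are
-- the pairs reachable from (Φ₁,Φ₂); two flags are equal iff their pairs are.

MixFlag : {n : ℕ} (M₁ : Premaniplex n) → Flag M₁ → (M₂ : Premaniplex n) → Flag M₂ → Set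
MixFlag M₁ Φ₁ M₂ Φ₂ =
  Σ (Flag M₁ × Flag M₂) λ p → ∃[ w ] (actM M₁ w Φ₁ ≡ proj₁ p × actM M₂ w Φ₂ ≡ proj₂ p)

mixR : {n : ℕ} (M₁ : Premaniplex n) (Φ₁ : Flag M₁) (M₂ : Premaniplex n) (Φ₂ : Flag M₂) →
       Fin n → MixFlag M₁ Φ₁ M₂ Φ₂ → MixFlag M₁ Φ₁ M₂ Φ₂
mixR M₁ Φ₁ M₂ Φ₂ i ((a , b) , w , e₁ , e₂) =
  (r M₁ i a , r M₂ i b) , i ∷ w , cong (r M₁ i) e₁ , cong (r M₂ i) e₂

_≈mix_ : {n : ℕ} {M₁ : Premaniplex n} {Φ₁ : Flag M₁} {M₂ : Premaniplex n} {Φ₂ : Flag M₂} →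
         MixFlag M₁ Φ₁ M₂ Φ₂ → MixFlag M₁ Φ₁ M₂ Φ₂ → Set
x ≈mix y = proj₁ x ≡ proj₁ y

-- Abstract n-polytopes (ranked formulation: a poset with a strictly
-- monotone rank function onto {-1,…,n}, encoded as Fin (n+2) with index 0
-- for rank -1).

module PosetNotions {Face : Set} (_≤_ : Face → Face → Set) {n : ℕ}
                    (rank : Face → Fin (suc (suc n))) where

  IsChain : (Face → Set) → Set
  IsChain C = ∀ a b → C a → C b → (a ≤ b) ⊎ (b ≤ a)

  IsMaximalChain : (Face → Set) → Set
  IsMaximalChain C = ∀ x → (∀ a → C a → (x ≤ a) ⊎ (a ≤ x)) → C x

  Between : Face → Face → Face → Set
  Between a c b = (a ≤ c) × (a ≢ c) × (c ≤ b) × (c ≢ b)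

  record FullFlag : Set where
    field
      face      : Fin (suc (suc n)) → Face
      face-rank : ∀ i → rank (face i) ≡ i
      face-mono : ∀ i j → i ≤ᶠ j → face i ≤ face j
  open FullFlag public

  Adjacent : FullFlag → FullFlag → Set
  Adjacent h h' = ∃[ j ] ((face h j ≢ face h' j) × (∀ k → k ≢ j → face h k ≡ face h' k))

  data Walk (Keep : FullFlag → Set) (g : FullFlag) : FullFlag → Set where
    here : ∀ h → (∀ j → face h j ≡ face g j) → Walk Keep g h
    step : ∀ h h' → Adjacent h h' → Keep h' → Walk Keep g h' → Walk Keep g h

  StronglyFlagConnected : Set
  StronglyFlagConnected =
    ∀ f g → Walk (λ h → ∀ j → face f j ≡ face g j → face h j ≡ face f j) g f

record Polytope (n : ℕ) : Set₁ where
  field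
    Face      : Set
    _≤_       : Face → Face → Set
    ≤-refl    : ∀ a → a ≤ a
    ≤-trans   : ∀ {a b c} → a ≤ b → b ≤ c → a ≤ c
    ≤-antisym : ∀ {a b} → a ≤ b → b ≤ a → a ≡ b
    rank      : Face → Fin (suc (suc n))
    rank-strict : ∀ {a b} → a ≤ b → a ≢ b → rank a <ᶠ rank b
  open PosetNotions _≤_ rank public
  field
    least     : Σ Face λ a → ∀ b → a ≤ b
    greatest  : Σ Face λ a → ∀ b → b ≤ a
    flags-full : ∀ (C : Face → Set) → IsChain C → IsMaximalChain C →
                 ∀ i → Σ Face λ a → C a × rank a ≡ i
    diamond   : ∀ a b → a ≤ b → toℕ (rank b) ≡ suc (suc (toℕ (rank a))) →
                Σ Face λ c → Σ Face λ d →
                  Between a c b × Between a d b × (c ≢ d) ×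
                  (∀ e → Between a e b → (e ≡ c) ⊎ (e ≡ d))
    strongly-flag-connected : StronglyFlagConnected

FlagOf : {n : ℕ} (P : Polytope n) → Set
FlagOf P = PosetNotions.FullFlag (Polytope._≤_ P) (Polytope.rank P)

faceOf : {n : ℕ} (P : Polytope n) → FlagOf P → Fin (suc (suc n)) → Polytope.Face P
faceOf P f k = PosetNotions.FullFlag.face {_≤_ = Polytope._≤_ P} {rank = Polytope.rank P} f k

-- rank-index of the faces changed by colour i (rank i ↦ index i+1)
colourIndex : {n : ℕ} → Fin n → Fin (suc (suc n))
colourIndex i = suc (inject₁ i)

-- A coloured graph given by a flag type F with equality _≈_ and the
-- colour-i neighbour map r is a polytope: it is a maniplex and is
-- isomorphic to the flag graph of an abstract n-polytope
-- (in which flags are i-adjacent iff they differ exactly in their rank-i face).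
record IsPolytopeOn {n : ℕ} {F : Set} (_≈_ : F → F → Set) (r : Fin n → F → F) : Set₁ where
  field
    no-semi-edges     : ∀ i Φ → (r i Φ ≈ Φ) → ⊥
    no-multiple-edges : ∀ i j Φ → i ≢ j → (r i Φ ≈ r j Φ) → ⊥
    P   : Polytope n
    iso : F → FlagOf P
    iso-injective  : ∀ Φ Ψ → (∀ k → faceOf P (iso Φ) k ≡ faceOf P (iso Ψ) k) → Φ ≈ Ψ
    iso-surjective : ∀ f → ∃[ Φ ] (∀ k → faceOf P (iso Φ) k ≡ faceOf P f k)
    iso-respects-≈ : ∀ Φ Ψ → Φ ≈ Ψ → ∀ k → faceOf P (iso Φ) k ≡ faceOf P (iso Ψ) k
    iso-adjacent   : ∀ i Φ →
      (faceOf P (iso (r i Φ)) (colourIndex i) ≢ faceOf P (iso Φ) (colourIndex i))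
      × (∀ k → k ≢ colourIndex i → faceOf P (iso (r i Φ)) k ≡ faceOf P (iso Φ) k)

MixIsPolytope : {n : ℕ} (M₁ : Premaniplex n) → Flag M₁ → (M₂ : Premaniplex n) → Flag M₂ → Set₁
MixIsPolytope M₁ Φ₁ M₂ Φ₂ = IsPolytopeOn (_≈mix_ {M₁ = M₁} {Φ₁} {M₂} {Φ₂}) (mixR M₁ Φ₁ M₂ Φ₂)

-- Automorphisms (colour-preserving graph automorphisms, acting on the right:
-- Φγ = fun γ Φ).

record Aut {n : ℕ} (M : Premaniplex n) : Set where
  field
    fun    : Flag M → Flag M
    inv    : Flag M → Flag M
    inv-l  : ∀ Φ → inv (fun Φ) ≡ Φ
    inv-r  : ∀ Φ → fun (inv Φ) ≡ Φ
    colour : ∀ i Φ → fun (r M i Φ) ≡ r M i (fun Φ)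
open Aut public

-- A section of Ψ in M on k colours is given by the embedding
-- emb : Fin k → Fin n of its (shifted) colours: colour c of the section is
-- colour emb c of M.  Its flags are those reachable from Ψ using these
-- colours, and a word u over Fin k acts on it as map emb u acts on M.

InSection : {n k : ℕ} (M : Premaniplex n) → (Fin k → Fin n) → Flag M → Flag M → Set
InSection M emb Ψ Φ = ∃[ u ] actM M (map emb u) Ψ ≡ Φ

SecStab : {n k : ℕ} (M : Premaniplex n) → (Fin k → Fin n) → Flag M → List (Fin k) → Set
SecStab M emb Ψ u = actM M (map emb u) Ψ ≡ Ψ

-- γ ∈ Γ(M₂) lies in X(K₂ | K₁) (regarded inside Γ(M₂)), where K_j is the
-- section of Ψ_j in M_j given by emb: γ maps K₂ to itself and its restriction
-- γ' to K₂ satisfies Ψ₂γ' = w Ψ₂ for some w ∈ N_{K₂} N_{K₁}.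
InVariance : {n k : ℕ} → (Fin k → Fin n) →
             (M₂ : Premaniplex n) → Flag M₂ → (M₁ : Premaniplex n) → Flag M₁ → Aut M₂ → Set
InVariance emb M₂ Ψ₂ M₁ Ψ₁ γ =
  (∀ Φ → InSection M₂ emb Ψ₂ Φ → InSection M₂ emb Ψ₂ (fun γ Φ))
  × (∃[ a ] ∃[ b ] (SecStab M₂ emb Ψ₂ a × SecStab M₁ emb Ψ₁ b
                    × fun γ Ψ₂ ≡ actM M₂ (map emb (a ++ b)) Ψ₂))

facetEmb : {m : ℕ} → Fin (suc m) → Fin (suc (suc m))
facetEmb = inject₁

vertexFigureEmb : {m : ℕ} → Fin (suc m) → Fin (suc (suc m))
vertexFigureEmb = suc

medialEmb : {m : ℕ} → Fin m → Fin (suc (suc m))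
medialEmb i = suc (inject₁ i)

{-# OPTIONS --safe #-}
-- By admissibility the stabiliser of Ψ₂, conjugated to Φ₂, lies in Stab(Ψ) and so
-- normalises the stabiliser of Φ₁; hence a b a⁻¹ fixes Ψ₁ whenever a fixes Ψ₂ and b
-- fixes Ψ₁.  So γ ∈ X(K₂ | K₁) yields a word in the facet colours that fixes Ψ₁ and
-- carries Ψ₂ to Ψ₂γ, and γ ∈ X(L₂ | L₁) one in the vertex-figure colours.  In the mix
-- both words take (Ψ₁ , Ψ₂) to (Ψ₁ , Ψ₂γ), so these two flags of the polytope share
-- their base vertex and their facet.  Strong flag connectivity joins them by a path
-- of flags with that vertex and facet, which the diamond condition turns into a word
-- in the medial colours; it fixes Ψ₁ and carries Ψ₂ to Ψ₂γ, i.e. γ ∈ X(N₂ | N₁).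
module Submission where

open import Defs
open import Data.Nat using (ℕ; suc)
open import Data.Product using (_×_; ∃-syntax)
open import Relation.Binary.PropositionalEquality using (_≡_)

open import Data.Nat using (s≤s)
open import Data.Nat.Properties using (<⇒≤)
open import Data.Fin using (Fin; zero; suc; inject₁; toℕ) renaming (_<_ to _<ᶠ_)
open import Data.Fin.Properties using (toℕ-inject₁; ≤̄⇒inject₁<; <⇒≢; <-trans; any?; _≟_) renaming (≤-refl to ≤ᶠ-refl)
open import Data.List using (List; []; _∷_; _++_; map; reverse)
open import Data.List.Properties using (++-assoc; map-++; reverse-++; reverse-involutive; reverse-map; unfold-reverse)
open import Data.Product using (_,_; proj₁; proj₂)
open import Data.Product.Properties using (,-injective)
open import Data.Sum using (_⊎_; inj₁; inj₂)
open import Data.Empty using (⊥-elim)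
open import Function using (_∘_)
open import Relation.Nullary using (yes; no)
open import Relation.Binary.PropositionalEquality
  using (_≢_; _≗_; refl; sym; trans; cong; cong₂; subst; subst₂; module ≡-Reasoning)

open ≡-Reasoning

act-++ : {F : Set} {n : ℕ} (r : Fin n → F → F) (u v : List (Fin n)) →
         act r (u ++ v) ≗ act r u ∘ act r v
act-++ r []      v x = refl
act-++ r (i ∷ u) v x = cong (r i) (act-++ r u v x)

act-map-++ : {F : Set} {n k : ℕ} (r : Fin n → F → F) (emb : Fin k → Fin n) (u v : List (Fin k)) →
             act r (map emb (u ++ v)) ≗ act r (map emb u) ∘ act r (map emb v)
act-map-++ r emb u v x = trans (cong (λ l → act r l x) (map-++ emb u v)) (act-++ r (map emb u) (map emb v) x)

conjugate : {n : ℕ} → List (Fin n) → List (Fin n) → List (Fin n)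
conjugate w u = reverse w ++ u ++ w

reverse-conjugate : {n : ℕ} (w u : List (Fin n)) → reverse (conjugate w u) ≡ conjugate w (reverse u)
reverse-conjugate w u = begin
  reverse (reverse w ++ u ++ w)                   ≡⟨ reverse-++ (reverse w) (u ++ w) ⟩
  reverse (u ++ w) ++ reverse (reverse w)         ≡⟨ cong₂ _++_ (reverse-++ u w) (reverse-involutive w) ⟩
  (reverse w ++ reverse u) ++ w                   ≡⟨ ++-assoc (reverse w) (reverse u) w ⟩
  reverse w ++ reverse u ++ w                     ∎

map-conjugate : {n k : ℕ} (emb : Fin k → Fin n) (a b : List (Fin k)) →
                map emb (a ++ b ++ reverse a) ≡ map emb a ++ map emb b ++ reverse (map emb a)
map-conjugate emb a b = begin
  map emb (a ++ b ++ reverse a)                   ≡⟨ map-++ emb a (b ++ reverse a) ⟩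
  map emb a ++ map emb (b ++ reverse a)           ≡⟨ cong (map emb a ++_) (map-++ emb b (reverse a)) ⟩
  map emb a ++ map emb b ++ map emb (reverse a)   ≡⟨ cong (λ l → map emb a ++ map emb b ++ l) (reverse-map emb a) ⟩
  map emb a ++ map emb b ++ reverse (map emb a)   ∎

fun-act : {n : ℕ} (M : Premaniplex n) (γ : Aut M) (u : List (Fin n)) (x : Flag M) →
          fun γ (actM M u x) ≡ actM M u (fun γ x)
fun-act M γ []      x = refl
fun-act M γ (i ∷ u) x = trans (colour γ i _) (cong (r M i) (fun-act M γ u x))

module WordAction {n : ℕ} (M : Premaniplex n) where

  infixr 5 _·_
  _·_ : List (Fin n) → Flag M → Flag M
  u · x = actM M u x

  ·-++ : ∀ u v x → (u ++ v) · x ≡ u · v · x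
  ·-++ = act-++ (r M)

  ·-++₃ : ∀ u v w x → (u ++ v ++ w) · x ≡ u · v · w · x
  ·-++₃ u v w x = trans (·-++ u (v ++ w) x) (cong (u ·_) (·-++ v w x))

  reverse-·-cancel : ∀ u x → reverse u · u · x ≡ x
  reverse-·-cancel []      x = refl
  reverse-·-cancel (i ∷ u) x = begin
    reverse (i ∷ u) · r M i (u · x)        ≡⟨ cong (_· r M i (u · x)) (unfold-reverse i u) ⟩
    (reverse u ++ i ∷ []) · r M i (u · x)  ≡⟨ ·-++ (reverse u) (i ∷ []) _ ⟩
    reverse u · r M i (r M i (u · x))      ≡⟨ cong (reverse u ·_) (r-invol M i _) ⟩
    reverse u · u · x                      ≡⟨ reverse-·-cancel u x ⟩
    x                                      ∎

  ·-reverse-cancel : ∀ u x → u · reverse u · x ≡ x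
  ·-reverse-cancel u x =
    subst (λ v → v · reverse u · x ≡ x) (reverse-involutive u) (reverse-·-cancel (reverse u) x)

  stab-reverse : ∀ {x} u → Stab M x u → Stab M x (reverse u)
  stab-reverse {x} u ux≡x = trans (cong (reverse u ·_) (sym ux≡x)) (reverse-·-cancel u x)

  ·-++-reverse-stab : ∀ {x} a b → Stab M x a → (a ++ b ++ reverse a) · x ≡ (a ++ b) · x
  ·-++-reverse-stab {x} a b a∈ = begin
    (a ++ b ++ reverse a) · x    ≡⟨ ·-++₃ a b (reverse a) x ⟩
    a · b · reverse a · x        ≡⟨ cong (λ y → a · b · y) (stab-reverse a a∈) ⟩
    a · b · x                    ≡⟨ sym (·-++ a b x) ⟩
    (a ++ b) · x                 ∎

  ·-conjugate : ∀ w u x → conjugate w u · x ≡ reverse w · u · w · x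
  ·-conjugate w u x = trans (·-++ (reverse w) (u ++ w) x) (cong (reverse w ·_) (·-++ u w x))

  conjugate-·-conjugate : ∀ w u v x → conjugate w u · conjugate w v · x ≡ conjugate w (u ++ v) · x
  conjugate-·-conjugate w u v x = begin
    conjugate w u · conjugate w v · x              ≡⟨ ·-conjugate w u _ ⟩
    reverse w · u · w · conjugate w v · x          ≡⟨ cong (λ y → reverse w · u · w · y) (·-conjugate w v x) ⟩
    reverse w · u · w · reverse w · v · w · x      ≡⟨ cong (λ y → reverse w · u · y) (·-reverse-cancel w _) ⟩
    reverse w · u · v · w · x                      ≡⟨ cong (reverse w ·_) (sym (·-++ u v _)) ⟩
    reverse w · (u ++ v) · w · x                   ≡⟨ sym (·-conjugate w (u ++ v) x) ⟩
    conjugate w (u ++ v) · x                       ∎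

  stab-conjugate : ∀ {x} w u → Stab M (w · x) u → Stab M x (conjugate w u)
  stab-conjugate {x} w u u∈ = begin
    conjugate w u · x        ≡⟨ ·-conjugate w u x ⟩
    reverse w · u · w · x    ≡⟨ cong (reverse w ·_) u∈ ⟩
    reverse w · w · x        ≡⟨ reverse-·-cancel w x ⟩
    x                        ∎

  stab-unconjugate : ∀ {x} w u → Stab M x (conjugate w u) → Stab M (w · x) u
  stab-unconjugate {x} w u u∈ = begin
    u · w · x                          ≡⟨ sym (·-reverse-cancel w _) ⟩
    w · reverse w · u · w · x          ≡⟨ cong (w ·_) (trans (sym (·-conjugate w u x)) u∈) ⟩
    w · x                              ∎

-- the mix flag (Ψ₁ , Λ) lies in the emb-section of the mix flag (Ψ₁ , Ψ₂)
record SectionWord {n k : ℕ} (emb : Fin k → Fin n) (M₁ : Premaniplex n) (Ψ₁ : Flag M₁)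
                   (M₂ : Premaniplex n) (Ψ₂ Λ : Flag M₂) : Set where
  constructor sectionWord
  field
    word  : List (Fin k)
    fixes : Stab M₁ Ψ₁ (map emb word)
    moves : actM M₂ (map emb word) Ψ₂ ≡ Λ

sectionWord⇒inVariance :
  {n k : ℕ} {M₁ M₂ : Premaniplex n} {Ψ₁ : Flag M₁} {Ψ₂ : Flag M₂} (emb : Fin k → Fin n) (γ : Aut M₂) →
  SectionWord emb M₁ Ψ₁ M₂ Ψ₂ (fun γ Ψ₂) → InVariance emb M₂ Ψ₂ M₁ Ψ₁ γ
sectionWord⇒inVariance {M₂ = M₂} {Ψ₂ = Ψ₂} emb γ (sectionWord d d∈ dΨ₂≡) =
  preserves-section , [] , d , refl , d∈ , sym dΨ₂≡
  where
  open WordAction M₂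
  preserves-section : ∀ Φ → InSection M₂ emb Ψ₂ Φ → InSection M₂ emb Ψ₂ (fun γ Φ)
  preserves-section Φ (u , uΨ₂≡Φ) = u ++ d , (begin
    map emb (u ++ d) · Ψ₂        ≡⟨ act-map-++ (r M₂) emb u d Ψ₂ ⟩
    map emb u · map emb d · Ψ₂   ≡⟨ cong (map emb u ·_) dΨ₂≡ ⟩
    map emb u · fun γ Ψ₂         ≡⟨ sym (fun-act M₂ γ (map emb u) Ψ₂) ⟩
    fun γ (map emb u · Ψ₂)       ≡⟨ cong (fun γ) uΨ₂≡Φ ⟩
    fun γ Φ                      ∎)

module CommonlyAdmissible {n : ℕ} (T M₁ M₂ : Premaniplex n) (Ψ : Flag T) (Φ₁ : Flag M₁) (Φ₂ : Flag M₂)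
                          (adm₁ : Admissible M₁ Φ₁ T Ψ) (adm₂ : Admissible M₂ Φ₂ T Ψ) where

  stab-normalises : ∀ w a b → Stab M₂ (actM M₂ w Φ₂) a → Stab M₁ (actM M₁ w Φ₁) b →
                    Stab M₁ (actM M₁ w Φ₁) (a ++ b ++ reverse a)
  stab-normalises w a b a∈ b∈ = stab-unconjugate w (a ++ b ++ reverse a) (begin
      conjugate w (a ++ b ++ reverse a) · Φ₁
        ≡⟨ sym (conjugate-·-conjugate w a _ Φ₁) ⟩
      a′ · conjugate w (b ++ reverse a) · Φ₁
        ≡⟨ cong (a′ ·_) (sym (conjugate-·-conjugate w b _ Φ₁)) ⟩
      a′ · b′ · conjugate w (reverse a) · Φ₁
        ≡⟨ cong (λ v → a′ · b′ · v · Φ₁) (sym (reverse-conjugate w a)) ⟩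
      a′ · b′ · reverse a′ · Φ₁
        ≡⟨ sym (·-++₃ a′ b′ (reverse a′) Φ₁) ⟩
      (a′ ++ b′ ++ reverse a′) · Φ₁
        ≡⟨ proj₁ (proj₂ adm₁ a′ (proj₁ adm₂ a′ a′∈)) b′ (stab-conjugate w b b∈) ⟩
      Φ₁ ∎)
    where
    open WordAction M₁
    a′ b′ : List (Fin n)
    a′ = conjugate w a
    b′ = conjugate w b
    a′∈ : Stab M₂ Φ₂ a′
    a′∈ = WordAction.stab-conjugate M₂ w a a∈

  inVariance⇒sectionWord : ∀ w {k} (emb : Fin k → Fin n) (γ : Aut M₂) →
    InVariance emb M₂ (actM M₂ w Φ₂) M₁ (actM M₁ w Φ₁) γ →
    SectionWord emb M₁ (actM M₁ w Φ₁) M₂ (actM M₂ w Φ₂) (fun γ (actM M₂ w Φ₂))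
  inVariance⇒sectionWord w emb γ (_ , a , b , a∈ , b∈ , γΨ₂≡) =
    sectionWord (a ++ b ++ reverse a) fixes-Ψ₁ moves-Ψ₂
    where
    open WordAction M₂
    fixes-Ψ₁ : Stab M₁ (actM M₁ w Φ₁) (map emb (a ++ b ++ reverse a))
    fixes-Ψ₁ = subst (Stab M₁ (actM M₁ w Φ₁)) (sym (map-conjugate emb a b))
                     (stab-normalises w (map emb a) (map emb b) a∈ b∈)
    moves-Ψ₂ : map emb (a ++ b ++ reverse a) · w · Φ₂ ≡ fun γ (w · Φ₂)
    moves-Ψ₂ = begin
      map emb (a ++ b ++ reverse a) · w · Φ₂
        ≡⟨ cong (_· w · Φ₂) (map-conjugate emb a b) ⟩
      (map emb a ++ map emb b ++ reverse (map emb a)) · w · Φ₂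
        ≡⟨ ·-++-reverse-stab (map emb a) (map emb b) a∈ ⟩
      (map emb a ++ map emb b) · w · Φ₂
        ≡⟨ cong (_· w · Φ₂) (sym (map-++ emb a b)) ⟩
      map emb (a ++ b) · w · Φ₂
        ≡⟨ sym γΨ₂≡ ⟩
      fun γ (w · Φ₂) ∎

same-other-of-two : {A : Set} {c d x y z : A} →
                    (x ≡ c ⊎ x ≡ d) → (y ≡ c ⊎ y ≡ d) → (z ≡ c ⊎ z ≡ d) →
                    y ≢ x → z ≢ x → y ≡ z
same-other-of-two _        (inj₁ p) (inj₁ q) _   _   = trans p (sym q)
same-other-of-two _        (inj₂ p) (inj₂ q) _   _   = trans p (sym q)
same-other-of-two (inj₁ o) (inj₁ p) (inj₂ q) y≢x _   = ⊥-elim (y≢x (trans p (sym o)))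
same-other-of-two (inj₂ o) (inj₁ p) (inj₂ q) _   z≢x = ⊥-elim (z≢x (trans q (sym o)))
same-other-of-two (inj₁ o) (inj₂ p) (inj₁ q) _   z≢x = ⊥-elim (z≢x (trans q (sym o)))
same-other-of-two (inj₂ o) (inj₂ p) (inj₁ q) y≢x _   = ⊥-elim (y≢x (trans p (sym o)))

module _ {n : ℕ} (P : Polytope n) where
  open Polytope P

  private
    below above : Fin n → Fin (suc (suc n))
    below c = inject₁ (inject₁ c)
    above c = suc (suc c)

    below<colourIndex : ∀ c → below c <ᶠ colourIndex c
    below<colourIndex c = ≤̄⇒inject₁< (≤ᶠ-refl {x = inject₁ c})

    colourIndex<above : ∀ c → colourIndex c <ᶠ above c
    colourIndex<above c = s≤s (≤̄⇒inject₁< (≤ᶠ-refl {x = c}))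

    toℕ-above : ∀ c → toℕ (above c) ≡ suc (suc (toℕ (below c)))
    toℕ-above c = cong (λ k → suc (suc k)) (sym (trans (toℕ-inject₁ (inject₁ c)) (toℕ-inject₁ c)))

  face-rank-injective : ∀ (h h′ : FullFlag) {i j} → face h i ≡ face h′ j → i ≡ j
  face-rank-injective h h′ {i} {j} e = trans (sym (face-rank h i)) (trans (cong rank e) (face-rank h′ j))

  flag-between : ∀ c (h : FullFlag) →
                 Between (face h (below c)) (face h (colourIndex c)) (face h (above c))
  flag-between c h =
      face-mono h _ _ (<⇒≤ (below<colourIndex c))
    , <⇒≢ (below<colourIndex c) ∘ face-rank-injective h h
    , face-mono h _ _ (<⇒≤ (colourIndex<above c))
    , <⇒≢ (colourIndex<above c) ∘ face-rank-injective h h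

  colour-neighbour-unique :
    ∀ c (h h₁ h₂ : FullFlag) →
    (∀ k → k ≢ colourIndex c → face h₁ k ≡ face h k) →
    (∀ k → k ≢ colourIndex c → face h₂ k ≡ face h k) →
    face h₁ (colourIndex c) ≢ face h (colourIndex c) →
    face h₂ (colourIndex c) ≢ face h (colourIndex c) →
    face h₁ (colourIndex c) ≡ face h₂ (colourIndex c)
  colour-neighbour-unique c h h₁ h₂ h₁≈h h₂≈h =
    same-other-of-two (one-of-two h (λ _ _ → refl)) (one-of-two h₁ h₁≈h) (one-of-two h₂ h₂≈h)
    where
    below≢ : below c ≢ colourIndex c
    below≢ = <⇒≢ (below<colourIndex c)
    above≢ : above c ≢ colourIndex c
    above≢ = <⇒≢ (colourIndex<above c) ∘ sym
    a b : Face
    a = face h (below c)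
    b = face h (above c)
    a≤b : a ≤ b
    a≤b = face-mono h _ _ (<⇒≤ (<-trans (below<colourIndex c) (colourIndex<above c)))
    rank-gap : toℕ (rank b) ≡ suc (suc (toℕ (rank a)))
    rank-gap = trans (cong toℕ (face-rank h (above c)))
                     (trans (toℕ-above c) (cong (λ i → suc (suc (toℕ i))) (sym (face-rank h (below c)))))
    D = diamond a b a≤b rank-gap
    one-of-two : ∀ h′ → (∀ k → k ≢ colourIndex c → face h′ k ≡ face h k) →
                 (face h′ (colourIndex c) ≡ proj₁ D) ⊎ (face h′ (colourIndex c) ≡ proj₁ (proj₂ D))
    one-of-two h′ h′≈h = proj₂ (proj₂ (proj₂ (proj₂ (proj₂ D)))) _
      (subst₂ (λ x y → Between x (face h′ (colourIndex c)) y)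
              (h′≈h (below c) below≢) (h′≈h (above c) above≢) (flag-between c h′))

Untouched : {n k : ℕ} → (Fin k → Fin n) → Fin (suc (suc n)) → Set
Untouched emb j = ∀ c → j ≢ colourIndex (emb c)

module _ {n : ℕ} {F : Set} {_≈_ : F → F → Set} {r : Fin n → F → F} (isP : IsPolytopeOn _≈_ r) where
  open IsPolytopeOn isP
  open Polytope P using (Face; FullFlag; face; Walk; here; step; strongly-flag-connected)

  faces : F → Fin (suc (suc n)) → Face
  faces X = faceOf P (iso X)

  untouched-faces-act : ∀ {k} (emb : Fin k → Fin n) {j} → Untouched emb j →
                        ∀ u X → faces (act r (map emb u) X) j ≡ faces X j
  untouched-faces-act emb j∉ []      X = refl
  untouched-faces-act emb j∉ (c ∷ u) X =
    trans (proj₂ (iso-adjacent (emb c) (act r (map emb u) X)) _ (j∉ c)) (untouched-faces-act emb j∉ u X)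

  faces-r-adjacent : ∀ c X (h h′ : FullFlag) → (∀ j → faces X j ≡ face h j) →
                     face h (colourIndex c) ≢ face h′ (colourIndex c) →
                     (∀ j → j ≢ colourIndex c → face h j ≡ face h′ j) →
                     ∀ j → faces (r c X) j ≡ face h′ j
  faces-r-adjacent c X h h′ X≈h moved fixed j with j ≟ colourIndex c
  ... | yes refl = colour-neighbour-unique P c h (iso (r c X)) h′
                     (λ k k≢ → trans (proj₂ (iso-adjacent c X) k k≢) (X≈h k))
                     (λ k k≢ → sym (fixed k k≢))
                     (λ q → proj₁ (iso-adjacent c X) (trans q (sym (X≈h _))))
                     (moved ∘ sym)
  ... | no j≢ = trans (proj₂ (iso-adjacent c X) j j≢) (trans (X≈h j) (fixed j j≢))

  KeepsCommonFaces : FullFlag → FullFlag → FullFlag → Set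
  KeepsCommonFaces f g h = ∀ j → face f j ≡ face g j → face h j ≡ face f j

  -- A step of the walk cannot change a face that f and g share, so it changes a face
  -- touched by emb; the diamond condition makes that colour of emb follow the step.
  walk⇒word : ∀ {k} (emb : Fin k → Fin n) (f : FullFlag) (Y : F) →
              (∀ j → Untouched emb j → face f j ≡ faces Y j) →
              ∀ h → KeepsCommonFaces f (iso Y) h → Walk (KeepsCommonFaces f (iso Y)) (iso Y) h →
              ∀ X → (∀ j → faces X j ≡ face h j) → ∃[ u ] act r (map emb u) X ≈ Y
  walk⇒word emb f Y agree h _ (here .h h≈Y) X X≈h =
    [] , iso-injective X Y (λ j → trans (X≈h j) (h≈Y j))
  walk⇒word emb f Y agree h keeps (step .h h′ (j , moved , fixed) keeps′ walk) X X≈h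
    with any? (λ c → j ≟ colourIndex (emb c))
  ... | no j∉ = ⊥-elim (moved (trans (keeps j common) (sym (keeps′ j common))))
    where
    common : face f j ≡ faces Y j
    common = agree j (λ c e → j∉ (c , e))
  ... | yes (c , refl) =
    let (u , uX′≈Y) = walk⇒word emb f Y agree h′ keeps′ walk (r (emb c) X)
                                 (faces-r-adjacent (emb c) X h h′ X≈h moved fixed)
    in u ++ c ∷ [] , subst (_≈ Y) (sym (act-map-++ r emb u (c ∷ []) X)) uX′≈Y

  section-connected : ∀ {k} (emb : Fin k → Fin n) X Y →
                      (∀ j → Untouched emb j → faces X j ≡ faces Y j) → ∃[ u ] act r (map emb u) X ≈ Y
  section-connected emb X Y agree =
    walk⇒word emb (iso X) Y agree (iso X) (λ _ _ → refl)
              (strongly-flag-connected (iso X) (iso Y)) X (λ _ → refl)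

untouched-by-medial : ∀ {m} j → Untouched (medialEmb {m}) j →
                      Untouched (facetEmb {m}) j ⊎ Untouched (vertexFigureEmb {m}) j
untouched-by-medial zero          _  = inj₁ λ _ ()
untouched-by-medial (suc zero)    _  = inj₂ λ _ ()
-- colourIndex (facetEmb (suc c)) and colourIndex (medialEmb c) are the same index
untouched-by-medial (suc (suc j)) j∉ = inj₁ λ { zero () ; (suc c) → j∉ c }

module _ {m : ℕ} {F : Set} {_≈_ : F → F → Set} {r : Fin (suc (suc m)) → F → F}
         (isP : IsPolytopeOn _≈_ r) where
  open IsPolytopeOn isP using (iso-respects-≈)

  facet∩vertexFigure⊆medial : ∀ X uK uL →
    act r (map vertexFigureEmb uL) X ≈ act r (map facetEmb uK) X →
    ∃[ d ] act r (map medialEmb d) X ≈ act r (map facetEmb uK) X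
  facet∩vertexFigure⊆medial X uK uL uLX≈uKX = section-connected isP medialEmb X _ agree
    where
    agree : ∀ j → Untouched medialEmb j → faces isP X j ≡ faces isP (act r (map facetEmb uK) X) j
    agree j j∉ with untouched-by-medial j j∉
    ... | inj₁ j∉K = sym (untouched-faces-act isP facetEmb j∉K uK X)
    ... | inj₂ j∉L = trans (sym (untouched-faces-act isP vertexFigureEmb j∉L uL X))
                           (iso-respects-≈ _ _ uLX≈uKX j)

module Mix {n : ℕ} (M₁ : Premaniplex n) (Φ₁ : Flag M₁) (M₂ : Premaniplex n) (Φ₂ : Flag M₂) where

  proj₁-act-mixR : ∀ u (X : MixFlag M₁ Φ₁ M₂ Φ₂) →
    proj₁ (act (mixR M₁ Φ₁ M₂ Φ₂) u X) ≡ (actM M₁ u (proj₁ (proj₁ X)) , actM M₂ u (proj₂ (proj₁ X)))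
  proj₁-act-mixR []      X = refl
  proj₁-act-mixR (i ∷ u) X = cong (λ (x₁ , x₂) → r M₁ i x₁ , r M₂ i x₂) (proj₁-act-mixR u X)

  module _ (w : List (Fin n)) where

    root : MixFlag M₁ Φ₁ M₂ Φ₂
    root = (actM M₁ w Φ₁ , actM M₂ w Φ₂) , w , refl , refl

    sectionWord⇒mix : ∀ {k} {emb : Fin k → Fin n} {Λ} →
      (s : SectionWord emb M₁ (actM M₁ w Φ₁) M₂ (actM M₂ w Φ₂) Λ) →
      proj₁ (act (mixR M₁ Φ₁ M₂ Φ₂) (map emb (SectionWord.word s)) root) ≡ (actM M₁ w Φ₁ , Λ)
    sectionWord⇒mix {emb = emb} (sectionWord u fixes moves) =
      trans (proj₁-act-mixR (map emb u) root) (cong₂ _,_ fixes moves)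

    mix⇒sectionWord : ∀ {k} {emb : Fin k → Fin n} {Λ} u →
      proj₁ (act (mixR M₁ Φ₁ M₂ Φ₂) (map emb u) root) ≡ (actM M₁ w Φ₁ , Λ) →
      SectionWord emb M₁ (actM M₁ w Φ₁) M₂ (actM M₂ w Φ₂) Λ
    mix⇒sectionWord {emb = emb} u uX≡ =
      let (fixes , moves) = ,-injective (trans (sym (proj₁-act-mixR (map emb u) root)) uX≡)
      in sectionWord u fixes moves

module _ {m : ℕ} {M₁ M₂ : Premaniplex (suc (suc m))} {Φ₁ : Flag M₁} {Φ₂ : Flag M₂} where
  open Mix M₁ Φ₁ M₂ Φ₂

  mix-sectionWord-medial : MixIsPolytope M₁ Φ₁ M₂ Φ₂ → ∀ w {Λ} →
    SectionWord facetEmb M₁ (actM M₁ w Φ₁) M₂ (actM M₂ w Φ₂) Λ →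
    SectionWord vertexFigureEmb M₁ (actM M₁ w Φ₁) M₂ (actM M₂ w Φ₂) Λ →
    SectionWord medialEmb M₁ (actM M₁ w Φ₁) M₂ (actM M₂ w Φ₂) Λ
  mix-sectionWord-medial isP w sK sL =
    let (d , dX≈uKX) = facet∩vertexFigure⊆medial isP (root w) (SectionWord.word sK) (SectionWord.word sL)
                         (trans (sectionWord⇒mix w sL) (sym (sectionWord⇒mix w sK)))
    in mix⇒sectionWord w d (trans dX≈uKX (sectionWord⇒mix w sK))

proposition6p2 : (m : ℕ) (T M₁ M₂ : Premaniplex (suc (suc m)))
    (Ψ : Flag T) (Φ₁ : Flag M₁) (Φ₂ : Flag M₂) →
    Admissible M₁ Φ₁ T Ψ → Admissible M₂ Φ₂ T Ψ →
    MixIsPolytope M₁ Φ₁ M₂ Φ₂ →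
    (Ψ₁ : Flag M₁) (Ψ₂ : Flag M₂) →
    ∃[ w ] (actM M₁ w Φ₁ ≡ Ψ₁ × actM M₂ w Φ₂ ≡ Ψ₂) →
    (γ : Aut M₂) →
    InVariance facetEmb M₂ Ψ₂ M₁ Ψ₁ γ →
    InVariance vertexFigureEmb M₂ Ψ₂ M₁ Ψ₁ γ →
    InVariance medialEmb M₂ Ψ₂ M₁ Ψ₁ γ
proposition6p2 m T M₁ M₂ Ψ Φ₁ Φ₂ adm₁ adm₂ isP _ _ (w , refl , refl) γ γ∈XK γ∈XL =
  sectionWord⇒inVariance medialEmb γ
    (mix-sectionWord-medial isP w
      (inVariance⇒sectionWord w facetEmb γ γ∈XK)
      (inVariance⇒sectionWord w vertexFigureEmb γ γ∈XL))
  where open CommonlyAdmissible T M₁ M₂ Ψ Φ₁ Φ₂ adm₁ adm₂
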